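{- Let $f=(f_1^{c_1},\dots,f_n^{c_n})\in\mathbb N_0^{(r,n)}$ and $\pi(f)=\gamma=(c'_1,\dots,c'_n;\sigma)$. Define $\lambda_i=f_{\sigma(i)}-|\{j\in\mathrm{Des}_G(\gamma): j\le i-1\}|$ for $1\le i\le n$. Then $\lambda(f):=(\lambda_1,\dots,\lambda_n)$ is a partition, i.e. a nondecreasing sequence of nonnegative integers.
   Context: $G(r,n)$ is the set of $r$-colored permutations $\gamma=(c_1,\dots,c_n;\sigma)$, $c_i\in\{0,\dots,r-1\}$, $\sigma\in S_n$, written $\gamma=[\gamma(1),\dots,\gamma(n)]=[\sigma(1)^{c_1},\dots,\sigma(n)^{c_n}]$. Colored integers $x^c$ ($x^0=x$) are totally ordered by: uncolored integers in natural order; every $x^c$ with $c\ge1$ is smaller than every uncolored integer (including $0$); for $c,d\ge1$, $x^c<y^d$ iff $x>y$, or $x=y$ and $c>d$. $\mathrm{Des}_G(\gamma)=\{i\in\{0,\dots,n-1\}:\gamma(i)>\gamma(i+1)\}$ with $\gamma(0):=0$. $\mathbb N_0^{(r,n)}$ is the set of $n$-tuples $(f_1^{c_1},\dots,f_n^{c_n})$ with $f_i\in\mathbb N$, $c_i\in\{0,\dots,r-1\}$, $c_i=0$ whenever $f_i=0$. For such $f$ and $\nu\in\mathbb N$ let $A_\nu=\{i^{c_i}:f_i=\nu\}$; arranging each nonempty $A_\nu$ increasingly and juxtaposing blocks in order of increasing $\nu$ gives the window notation of $\pi(f)\in G(r,n)$. -}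

module Defs where

open import Data.Bool using (Bool; true; false; if_then_else_; _∧_; _∨_)
open import Data.Nat using (ℕ; zero; suc; _<ᵇ_; _≡ᵇ_; _≤ᵇ_)
open import Data.Fin using (Fin; toℕ; inject₁) renaming (zero to fzero; suc to fsuc)
open import Data.Product using (_×_; _,_)
open import Data.Vec using (Vec; []; _∷_; lookup; allFin; map)
import Data.List as L
open import Data.Integer using (ℤ; +_; _-_)

-- A colored integer x^c is represented as the pair (x , c); c = 0 means uncolored.
ColInt : Set
ColInt = ℕ × ℕ

_<ᶜ_ : ColInt → ColInt → Bool
(x , zero)  <ᶜ (y , zero)  = x <ᵇ y
(x , suc _) <ᶜ (y , zero)  = true
(x , zero)  <ᶜ (y , suc _) = false
(x , suc c) <ᶜ (y , suc d) = (y <ᵇ x) ∨ ((x ≡ᵇ y) ∧ (d <ᵇ c))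

module _ {n : ℕ} (f : Fin n → ℕ) (c : Fin n → ℕ) where

  col : Fin n → ColInt
  col i = (suc (toℕ i) , c i)

  -- i comes before j in π(f): smaller block value f, or same block and
  -- smaller colored integer
  keyLt : Fin n → Fin n → Bool
  keyLt i j = (f i <ᵇ f j) ∨ ((f i ≡ᵇ f j) ∧ (col i <ᶜ col j))

  insert : {m : ℕ} → Fin n → Vec (Fin n) m → Vec (Fin n) (suc m)
  insert i [] = i ∷ []
  insert i (j ∷ js) = if keyLt i j then i ∷ j ∷ js else j ∷ insert i js

  sortIdx : {m : ℕ} → Vec (Fin n) m → Vec (Fin n) m
  sortIdx [] = []
  sortIdx (i ∷ is) = insert i (sortIdx is)

  -- σ as a vector (0-indexed positions): σ(k+1) = suc (toℕ (lookup sigma k))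
  sigma : Vec (Fin n) n
  sigma = sortIdx (allFin n)

  -- window notation of γ = π(f): γ(k+1) = σ(k+1)^{c_{σ(k+1)}}
  window : Vec ColInt n
  window = map col sigma

  extWindow : Vec ColInt (suc n)
  extWindow = (0 , 0) ∷ window

  isDes : Fin n → Bool
  isDes j = lookup extWindow (fsuc j) <ᶜ lookup extWindow (inject₁ j)

  -- for position i = k+1: |{ j ∈ Des_G(γ) : j ≤ i-1 = k }|
  desCount : Fin n → ℕ
  desCount k = L.length (L.filterᵇ (λ j → (toℕ j ≤ᵇ toℕ k) ∧ isDes j) (L.allFin n))

  lam : Fin n → ℤ
  lam k = + f (lookup sigma k) - + desCount k

-- Let g_i = f_{σ(i)} and let d_i count the descents of γ at positions 0, …, i-1, so that
-- λ_i = g_i - d_i. Since σ lists the blocks A_ν in increasing order of ν and each block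
-- increasingly, g is nondecreasing, and a descent at position i ≥ 1 can only occur between
-- two blocks, where g strictly increases: g_{i+1} ≥ g_i + [i ∈ Des]. Hence λ is nondecreasing.
-- A descent at 0 means γ(1) is colored, which forces f_{σ(1)} ≥ 1; hence λ_1 ≥ 0.
module Submission where

open import Defs
open import Data.Nat using (ℕ; _<_; _≤_)
open import Data.Fin using (Fin; toℕ)
open import Data.Integer using (ℤ; +_) renaming (_≤_ to _≤ℤ_)
open import Data.Product using (_×_)
open import Relation.Binary.PropositionalEquality using (_≡_)

open import Data.Bool using (Bool; true; false; _∧_; _∨_)
open import Data.Fin using (inject₁) renaming (zero to fzero; suc to fsuc)
open import Data.Integer using (_-_; _⊖_; +≤+)
import Data.Integer.Properties as ℤₚ
import Data.List as List
open import Data.Nat using (zero; suc; _+_; _<ᵇ_; _≡ᵇ_; _≤ᵇ_; z≤n; s≤s)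
open import Data.Nat.Properties using (+-comm; +-identityʳ; +-suc; +-commutativeSemigroup)
open import Algebra.Properties.CommutativeSemigroup +-commutativeSemigroup using (x∙yz≈y∙xz)
open import Data.Product using (_,_)
open import Data.Vec using (Vec; []; _∷_; head; lookup; allFin)
open import Data.Vec.Properties using (lookup-map)
open import Data.Vec.Relation.Unary.Linked using (Linked; []; [-]; _∷_)
open import Function using (_∘_)
open import Relation.Binary.Bundles using (Preorder)
open import Relation.Binary.PropositionalEquality
  using (refl; sym; trans; cong; cong₂; subst; module ≡-Reasoning)

fromBool : Bool → ℕ
fromBool true  = 1
fromBool false = 0

<ᵇ-asym : ∀ a b → (a <ᵇ b) ≡ true → (b <ᵇ a) ≡ false
<ᵇ-asym zero    (suc b) _ = refl
<ᵇ-asym (suc a) (suc b) h = <ᵇ-asym a b h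

lex-asym : ∀ a b (X Y : Bool) → (X ≡ true → Y ≡ false) →
           ((a <ᵇ b) ∨ ((a ≡ᵇ b) ∧ X)) ≡ true → ((b <ᵇ a) ∨ ((b ≡ᵇ a) ∧ Y)) ≡ false
lex-asym zero    zero    X Y X⇒¬Y h = X⇒¬Y h
lex-asym zero    (suc b) X Y X⇒¬Y h = refl
lex-asym (suc a) (suc b) X Y X⇒¬Y h = lex-asym a b X Y X⇒¬Y h

-- The same with the tie test written the other way round, as in the colored case of _<ᶜ_.
lex-asym′ : ∀ a b (X Y : Bool) → (X ≡ true → Y ≡ false) →
            ((a <ᵇ b) ∨ ((b ≡ᵇ a) ∧ X)) ≡ true → ((b <ᵇ a) ∨ ((a ≡ᵇ b) ∧ Y)) ≡ false
lex-asym′ zero    zero    X Y X⇒¬Y h = X⇒¬Y h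
lex-asym′ zero    (suc b) X Y X⇒¬Y h = refl
lex-asym′ (suc a) (suc b) X Y X⇒¬Y h = lex-asym′ a b X Y X⇒¬Y h

lex-false⇒≤ : ∀ a b (X : Bool) → ((b <ᵇ a) ∨ ((b ≡ᵇ a) ∧ X)) ≡ false → fromBool X + a ≤ b
lex-false⇒≤ zero    zero    false h = z≤n
lex-false⇒≤ zero    (suc b) false h = z≤n
lex-false⇒≤ zero    (suc b) true  h = s≤s z≤n
lex-false⇒≤ (suc a) (suc b) X     h =
  subst (_≤ suc b) (sym (+-suc (fromBool X) a)) (s≤s (lex-false⇒≤ a b X h))

<ᶜ-asym : ∀ p q → (p <ᶜ q) ≡ true → (q <ᶜ p) ≡ false
<ᶜ-asym (x , zero)  (y , zero)  h = <ᵇ-asym x y h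
<ᶜ-asym (x , suc c) (y , zero)  h = refl
<ᶜ-asym (x , suc c) (y , suc d) h = lex-asym′ y x (d <ᵇ c) (c <ᵇ d) (<ᵇ-asym d c) h

adjacent⇒monotone : ∀ {c ℓ₁ ℓ₂} (P : Preorder c ℓ₁ ℓ₂) → let open Preorder P in
  ∀ {n} (g : Fin (suc n) → Carrier) → (∀ j → g (inject₁ j) ≲ g (fsuc j)) →
  ∀ k l → toℕ k ≤ toℕ l → g k ≲ g l
adjacent⇒monotone P g step fzero    fzero    _ = Preorder.refl P
adjacent⇒monotone P {suc n} g step fzero (fsuc l) _ =
  Preorder.trans P (step fzero) (adjacent⇒monotone P (g ∘ fsuc) (step ∘ fsuc) fzero l z≤n)
adjacent⇒monotone P {suc n} g step (fsuc k) (fsuc l) (s≤s k≤l) =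
  adjacent⇒monotone P (g ∘ fsuc) (step ∘ fsuc) k l k≤l

Linked-adjacent : ∀ {a ℓ} {A : Set a} {R : A → A → Set ℓ} {n} {xs : Vec A (suc n)} →
  Linked R xs → ∀ j → R (lookup xs (inject₁ j)) (lookup xs (fsuc j))
Linked-adjacent {xs = _ ∷ _ ∷ _} (r ∷ _)  fzero    = r
Linked-adjacent {xs = _ ∷ _ ∷ _} (_ ∷ rs) (fsuc j) = Linked-adjacent rs j

count : ∀ {n} → (Fin n → Bool) → ℕ
count {zero}  p = 0
count {suc n} p = fromBool (p fzero) + count (p ∘ fsuc)

count-cong : ∀ {n} {p q : Fin n → Bool} → (∀ j → p j ≡ q j) → count p ≡ count q
count-cong {zero}  p≡q = refl
count-cong {suc n} p≡q = cong₂ _+_ (cong fromBool (p≡q fzero)) (count-cong (p≡q ∘ fsuc))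

count-false : ∀ n → count {n} (λ _ → false) ≡ 0
count-false zero    = refl
count-false (suc n) = count-false n

length-filterᵇ-tabulate : ∀ {a} {A : Set a} {n} (p : A → Bool) (g : Fin n → A) →
  List.length (List.filterᵇ p (List.tabulate g)) ≡ count (p ∘ g)
length-filterᵇ-tabulate {n = zero}  p g = refl
length-filterᵇ-tabulate {n = suc n} p g with p (g fzero)
... | true  = cong suc (length-filterᵇ-tabulate p (g ∘ fsuc))
... | false = length-filterᵇ-tabulate p (g ∘ fsuc)

-- |{ j : q j, j ≤ k }|, written exactly as desCount so that desCount f c = prefixCount (isDes f c).
prefixCount : ∀ {n} → (Fin n → Bool) → Fin n → ℕ
prefixCount {n} q k = List.length (List.filterᵇ (λ j → (toℕ j ≤ᵇ toℕ k) ∧ q j) (List.allFin n))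

prefixCount≡count : ∀ {n} (q : Fin n → Bool) k →
  prefixCount q k ≡ count (λ j → (toℕ j ≤ᵇ toℕ k) ∧ q j)
prefixCount≡count q k = length-filterᵇ-tabulate (λ j → (toℕ j ≤ᵇ toℕ k) ∧ q j) (λ j → j)

prefixCount-zero : ∀ {n} (q : Fin (suc n) → Bool) → prefixCount q fzero ≡ fromBool (q fzero)
prefixCount-zero {n} q = begin
  prefixCount q fzero                          ≡⟨ prefixCount≡count q fzero ⟩
  fromBool (q fzero) + count {n} (λ _ → false) ≡⟨ cong (_+_ (fromBool (q fzero))) (count-false n) ⟩
  fromBool (q fzero) + 0                       ≡⟨ +-identityʳ _ ⟩
  fromBool (q fzero)                           ∎
  where open ≡-Reasoning

prefixCount-shift : ∀ {n} (q : Fin (suc n) → Bool) k →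
  prefixCount q (fsuc k) ≡ fromBool (q fzero) + prefixCount (q ∘ fsuc) k
prefixCount-shift q k = begin
  prefixCount q (fsuc k)
    ≡⟨ prefixCount≡count q (fsuc k) ⟩
  fromBool (q fzero) + count (λ j → (toℕ j <ᵇ suc (toℕ k)) ∧ q (fsuc j))
    ≡⟨ cong (_+_ (fromBool (q fzero))) (count-cong (λ j → cong (_∧ q (fsuc j)) (<ᵇ-suc (toℕ j) (toℕ k)))) ⟩
  fromBool (q fzero) + count (λ j → (toℕ j ≤ᵇ toℕ k) ∧ q (fsuc j))
    ≡⟨ cong (_+_ (fromBool (q fzero))) (sym (prefixCount≡count (q ∘ fsuc) k)) ⟩
  fromBool (q fzero) + prefixCount (q ∘ fsuc) k
    ∎
  where
  open ≡-Reasoning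
  <ᵇ-suc : ∀ m n → (m <ᵇ suc n) ≡ (m ≤ᵇ n)
  <ᵇ-suc zero    n = refl
  <ᵇ-suc (suc m) n = refl

prefixCount-suc : ∀ {n} (q : Fin (suc n) → Bool) j →
  prefixCount q (fsuc j) ≡ fromBool (q (fsuc j)) + prefixCount q (inject₁ j)
prefixCount-suc q fzero = begin
  prefixCount q (fsuc fzero)                        ≡⟨ prefixCount-shift q fzero ⟩
  fromBool (q fzero) + prefixCount (q ∘ fsuc) fzero ≡⟨ cong (_+_ (fromBool (q fzero))) (prefixCount-zero (q ∘ fsuc)) ⟩
  fromBool (q fzero) + fromBool (q (fsuc fzero))    ≡⟨ +-comm (fromBool (q fzero)) _ ⟩
  fromBool (q (fsuc fzero)) + fromBool (q fzero)    ≡⟨ cong (_+_ (fromBool (q (fsuc fzero)))) (sym (prefixCount-zero q)) ⟩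
  fromBool (q (fsuc fzero)) + prefixCount q fzero   ∎
  where open ≡-Reasoning
prefixCount-suc q (fsuc j) = begin
  prefixCount q (fsuc (fsuc j))                  ≡⟨ prefixCount-shift q (fsuc j) ⟩
  Q₀ + prefixCount (q ∘ fsuc) (fsuc j)           ≡⟨ cong (_+_ Q₀) (prefixCount-suc (q ∘ fsuc) j) ⟩
  Q₀ + (Qⱼ + prefixCount (q ∘ fsuc) (inject₁ j)) ≡⟨ x∙yz≈y∙xz Q₀ Qⱼ _ ⟩
  Qⱼ + (Q₀ + prefixCount (q ∘ fsuc) (inject₁ j)) ≡⟨ cong (_+_ Qⱼ) (sym (prefixCount-shift q (inject₁ j))) ⟩
  Qⱼ + prefixCount q (inject₁ (fsuc j))          ∎
  where
  open ≡-Reasoning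
  Q₀ Qⱼ : ℕ
  Q₀ = fromBool (q fzero)
  Qⱼ = fromBool (q (fsuc (fsuc j)))

[+m]-[+n]≤[+o]-[+k+n] : ∀ {k m o} n → k + m ≤ o → + m - + n ≤ℤ + o - + (k + n)
[+m]-[+n]≤[+o]-[+k+n] {k} {m} {o} n k+m≤o = begin
  + m - + n         ≡⟨ ℤₚ.[+m]-[+n]≡m⊖n m n ⟩
  m ⊖ n             ≡⟨ sym (ℤₚ.+-cancelˡ-⊖ k m n) ⟩
  (k + m) ⊖ (k + n) ≤⟨ ℤₚ.⊖-monoˡ-≤ (k + n) k+m≤o ⟩
  o ⊖ (k + n)       ≡⟨ sym (ℤₚ.[+m]-[+n]≡m⊖n o (k + n)) ⟩
  + o - + (k + n)   ∎
  where open ℤₚ.≤-Reasoning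

module _ {n : ℕ} (f c : Fin n → ℕ) where

  keyLt-asym : ∀ i j → keyLt f c i j ≡ true → keyLt f c j i ≡ false
  keyLt-asym i j = lex-asym (f i) (f j) _ _ (<ᶜ-asym (col f c i) (col f c j))

  -- i may stand before j in π(f).
  Precedes : Fin n → Fin n → Set
  Precedes i j = keyLt f c j i ≡ false

  insert-head : (P : Fin n → Set) → ∀ i {m} (js : Vec (Fin n) (suc m)) →
    P i → P (head js) → P (head (insert f c i js))
  insert-head P i (k ∷ ks) Pi Pk with keyLt f c i k
  ... | true  = Pi
  ... | false = Pk

  insert-linked : ∀ i {m} (js : Vec (Fin n) m) → Linked Precedes js → Linked Precedes (insert f c i js)
  insert-linked i []           []  = [-]
  insert-linked i (j ∷ [])     [-] with keyLt f c i j in i<j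
  ... | true  = keyLt-asym i j i<j ∷ [-]
  ... | false = i<j ∷ [-]
  insert-linked i (j ∷ k ∷ ks) (j≼k ∷ ks↗) with keyLt f c i j in i<j
  ... | true  = keyLt-asym i j i<j ∷ j≼k ∷ ks↗
  ... | false = insert-head (Precedes j) i (k ∷ ks) i<j j≼k ∷ insert-linked i (k ∷ ks) ks↗

  sortIdx-linked : ∀ {m} (is : Vec (Fin n) m) → Linked Precedes (sortIdx f c is)
  sortIdx-linked []       = []
  sortIdx-linked (i ∷ is) = insert-linked i (sortIdx f c is) (sortIdx-linked is)

  precedes⇒f≤ : ∀ {i j} → Precedes i j → fromBool (col f c j <ᶜ col f c i) + f i ≤ f j
  precedes⇒f≤ {i} {j} = lex-false⇒≤ (f i) (f j) (col f c j <ᶜ col f c i)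

  colored⇒positive : (∀ i → f i ≡ 0 → c i ≡ 0) → ∀ i → fromBool (col f c i <ᶜ (0 , 0)) ≤ f i
  colored⇒positive uncolored-at-0 i with c i in ci | f i in fi
  ... | zero  | _     = z≤n
  ... | suc _ | suc _ = s≤s z≤n
  ... | suc _ | zero  with () <- trans (sym ci) (uncolored-at-0 i fi)

module _ {n : ℕ} (f c : Fin (suc n) → ℕ) where

  private
    σ : Vec (Fin (suc n)) (suc n)
    σ = sigma f c

    g : Fin (suc n) → ℕ
    g k = f (lookup σ k)

  isDes-zero : isDes f c fzero ≡ (col f c (lookup σ fzero) <ᶜ (0 , 0))
  isDes-zero = cong (_<ᶜ (0 , 0)) (lookup-map fzero (col f c) σ)

  isDes-suc : ∀ j → isDes f c (fsuc j) ≡ (col f c (lookup σ (fsuc j)) <ᶜ col f c (lookup σ (inject₁ j)))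
  isDes-suc j = cong₂ _<ᶜ_ (lookup-map (fsuc j) (col f c) σ) (lookup-map (inject₁ j) (col f c) σ)

  descent⇒increase : ∀ j → fromBool (isDes f c (fsuc j)) + g (inject₁ j) ≤ g (fsuc j)
  descent⇒increase j rewrite isDes-suc j =
    precedes⇒f≤ f c (Linked-adjacent (sortIdx-linked f c (allFin (suc n))) j)

  lam-first-nonneg : (∀ i → f i ≡ 0 → c i ≡ 0) → + 0 ≤ℤ lam f c fzero
  lam-first-nonneg uncolored-at-0 = ℤₚ.i≤j⇒0≤j-i (+≤+ first-bound)
    where
    first-bound : desCount f c fzero ≤ g fzero
    first-bound rewrite prefixCount-zero (isDes f c) | isDes-zero =
      colored⇒positive f c uncolored-at-0 (lookup σ fzero)

  lam-adjacent : ∀ j → lam f c (inject₁ j) ≤ℤ lam f c (fsuc j)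
  lam-adjacent j rewrite prefixCount-suc (isDes f c) j =
    [+m]-[+n]≤[+o]-[+k+n] (desCount f c (inject₁ j)) (descent⇒increase j)

lemma3p5 : (r n : ℕ) (f : Fin n → ℕ) (c : Fin n → ℕ) →
    (∀ i → c i < r) → (∀ i → f i ≡ 0 → c i ≡ 0) →
    (∀ k → + 0 ≤ℤ lam f c k) × (∀ k l → toℕ k ≤ toℕ l → lam f c k ≤ℤ lam f c l)
lemma3p5 r zero    f c _ _              = (λ ()) , (λ ())
lemma3p5 r (suc n) f c _ uncolored-at-0 = nonneg , monotone
  where
  monotone : ∀ k l → toℕ k ≤ toℕ l → lam f c k ≤ℤ lam f c l
  monotone = adjacent⇒monotone ℤₚ.≤-preorder (lam f c) (lam-adjacent f c)

  nonneg : ∀ k → + 0 ≤ℤ lam f c k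
  nonneg k = ℤₚ.≤-trans (lam-first-nonneg f c uncolored-at-0) (monotone fzero k z≤n)
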